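{- Let $G$ be a connected, simple, locally finite graph. For all $n\geq2$, the discrete fundamental group $A_1(G^{(n)})$ is abelian.
   Context: The reduced power $G^{(n)}$ is the quotient of the Cartesian power $G^n$ by the coordinate-permuting action of $\Sigma_n$: vertices are multisets of $n$ vertices of $G$, two adjacent iff one is obtained from the other by moving one element $u$ to an adjacent vertex $v$ of $G$. The discrete fundamental group $A_1(K)$ consists of based homotopy classes of graph maps $f:\mathbb{Z}\to K$ ($\mathbb{Z}$ the path graph on the integers; graph maps send equal-or-adjacent vertices to equal-or-adjacent vertices) with $f(i)=v_0$ for $|i|$ large, where a based homotopy is a graph map $h:\mathbb{Z}\times I_m\to K$ ($I_m$ the path on $\{0,\dots,m\}$, Cartesian product) with prescribed end rows and all rows based; the product is concatenation of loops. -}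

module Defs where

open import Data.Nat using (ℕ; zero; suc; _≤_; _<_)
open import Data.Integer using (ℤ; +_; -[1+_]; _+_; _-_; ∣_∣; 1ℤ)
open import Data.Fin using (Fin)
open import Data.Fin.Permutation using (Permutation′; _⟨$⟩ʳ_)
open import Data.List using (List)
open import Data.List.Membership.Propositional using (_∈_)
open import Data.Product using (Σ; ∃; ∃-syntax; _×_; _,_)
open import Data.Sum using (_⊎_)
open import Relation.Nullary using (¬_)
open import Relation.Binary.PropositionalEquality using (_≡_)
open import Relation.Binary.Construct.Closure.ReflexiveTransitive using (Star)

-- Simple graphs (possibly infinite vertex set).
-- Simple: adjacency is an irreflexive symmetric relation (no loops,
-- no multi-edges since it is a relation).

record Graph : Set₁ where
  field
    V     : Set
    Adj   : V → V → Set
    irrefl : ∀ v → ¬ Adj v v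
    sym   : ∀ {u v} → Adj u v → Adj v u

open Graph public

LocallyFinite : Graph → Set
LocallyFinite G = ∀ v → Σ (List (V G)) λ L → ∀ w → Adj G v w → w ∈ L

Connected : Graph → Set
Connected G = ∀ u v → Star (Adj G) u v

-- A "target graph" for graph maps: a vertex type with an equality
-- (setoid, needed for quotient graphs) and the "equal or adjacent"
-- relation.

record Target : Set₁ where
  field
    Vx  : Set
    _≈_ : Vx → Vx → Set
    EA  : Vx → Vx → Set

-- Reduced power G^(n): quotient of the Cartesian power G^n by the
-- coordinate-permuting action of Σ_n.

module _ (G : Graph) (n : ℕ) where

  Tuple : Set
  Tuple = Fin n → V G

  SameOrbit : Tuple → Tuple → Set
  SameOrbit x y = Σ (Permutation′ n) λ σ → ∀ i → x (σ ⟨$⟩ʳ i) ≡ y i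

  PowAdj : Tuple → Tuple → Set
  PowAdj x y = Σ (Fin n) λ k → Adj G (x k) (y k) × (∀ j → ¬ j ≡ k → x j ≡ y j)

  RedAdj : Tuple → Tuple → Set
  RedAdj x y = ∃[ x' ] ∃[ y' ] (SameOrbit x x' × SameOrbit y y' × PowAdj x' y')

  ReducedPower : Target
  ReducedPower = record
    { Vx  = Tuple
    ; _≈_ = SameOrbit
    ; EA  = λ x y → SameOrbit x y ⊎ RedAdj x y
    }

module _ (K : Target) (v₀ : Target.Vx K) where
  open Target K

  BasedBy : (ℤ → Vx) → ℕ → Set
  BasedBy f N = ∀ i → N ≤ ∣ i ∣ → f i ≈ v₀

  IsGraphMapℤ : (ℤ → Vx) → Set
  IsGraphMapℤ f = ∀ i → EA (f i) (f (i + 1ℤ))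

  record Loop : Set where
    field
      fun   : ℤ → Vx
      map   : IsGraphMapℤ fun
      bound : ℕ
      based : BasedBy fun bound

  open Loop public

  -- concatenation: f shifted so its support ends before 0,
  -- then g shifted so its support starts at 0.
  concat : Loop → Loop → ℤ → Vx
  concat f g -[1+ k ] = fun f (-[1+ k ] + + bound f)
  concat f g (+ k)    = fun g (+ k - + bound g)

  -- based homotopy: graph map h : ℤ × I_m → K (Cartesian product),
  -- with prescribed end rows and every row based.
  record BasedHomotopy (f g : ℤ → Vx) : Set where
    field
      m      : ℕ
      h      : ℤ → ℕ → Vx
      rows   : ∀ j → j ≤ m → ∀ i → EA (h i j) (h (i + 1ℤ) j)
      cols   : ∀ j → j < m → ∀ i → EA (h i j) (h i (suc j))
      start  : ∀ i → h i 0 ≈ f i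
      end    : ∀ i → h i m ≈ g i
      rowsBased : ∀ j → j ≤ m → ∃[ N ] BasedBy (λ i → h i j) N

  A₁Abelian : Set
  A₁Abelian = (f g : Loop) → BasedHomotopy (concat f g) (concat g f)

-- Loops of G⁽ⁿ⁾ are handled through lifts to Gⁿ: a loop at x₀ lifts to a list of moves, each
-- moving one token along an edge of G or idling, followed by one jump back onto x₀ inside its
-- Σₙ-orbit.  Local rewrites of move lists (inserting idles, swapping moves of distinct tokens,
-- cancelling a move against its reverse, pushing a permutation of the tokens past a move) change
-- the realised loop by one column of a based homotopy.  Conjugating by a walk C that gathers all
-- tokens at one vertex a turns loops at x₀ into loops at the gathered configuration, which every
-- permutation fixes; there the final jump becomes a move and a permutation that can be pushed
-- away, leaving a plain list of moves.  Such a loop splits into loops of single tokens; loops of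
-- different tokens commute because moves of different tokens commute (squares of Gⁿ), and two
-- loops of the same token commute once one of them is relabelled to another token, which exists
-- because n ≥ 2.

module Submission where

open import Defs hiding (sym)
open import Data.Nat as ℕ using (ℕ; zero; suc; z≤n; s≤s; _≤_)
import Data.Nat.Properties as ℕP
open import Data.Integer as ℤ using (ℤ; +_; -[1+_]; _⊖_; ∣_∣; 1ℤ)
import Data.Integer.Properties as ℤP
open import Data.Fin using (Fin; zero; suc; _≟_)
open import Data.Fin.Permutation
  using (Permutation′; _⟨$⟩ʳ_; _⟨$⟩ˡ_; inverseˡ; inverseʳ; flip; _∘ₚ_; transpose)
  renaming (id to idₚ)
open import Data.Vec.Functional using (updateAt)
open import Data.Vec.Functional.Properties using (updateAt-updates; updateAt-minimal; updateAt-commutes)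
open import Data.List using (List; []; _∷_; _++_; allFin; length; replicate)
open import Data.List.Membership.Propositional using (_∈_)
open import Data.List.Membership.Propositional.Properties using (∈-allFin)
open import Data.List.Relation.Unary.Any using (here; there)
open import Data.List.Properties using (++-assoc; ++-identityʳ; ++-monoid)
import Algebra.Solver.Monoid
open import Data.Product using (∃; _×_; _,_; proj₁; proj₂)
open import Data.Sum using (_⊎_; inj₁; inj₂)
open import Data.Unit using (⊤; tt)
open import Data.Empty using (⊥-elim)
open import Function using (const)
open import Relation.Nullary using (Dec; yes; no)
open import Relation.Binary.PropositionalEquality
open import Relation.Binary.Construct.Closure.ReflexiveTransitive using (Star; ε; _◅_; _◅◅_; reverse)

half≤∣⊖∣ : ∀ {m u} → m ℕ.+ m ≤ u → m ≤ ∣ u ⊖ m ∣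
half≤∣⊖∣ {m} le = subst (m ≤_) (sym (cong ∣_∣ (ℤP.⊖-≥ (ℕP.m+n≤o⇒n≤o m le)))) (ℕP.m+n≤o⇒m≤o∸n m le)

⊖-half : ∀ {m k} → k ≤ m ℕ.+ m → ((m ℕ.+ m) ℕ.∸ k) ⊖ m ≡ m ⊖ k
⊖-half {m} {k} k≤ = begin
  ((m ℕ.+ m) ℕ.∸ k) ⊖ m                     ≡⟨ ℤP.+-cancelˡ-⊖ k _ m ⟨
  (k ℕ.+ ((m ℕ.+ m) ℕ.∸ k)) ⊖ (k ℕ.+ m)     ≡⟨ cong₂ _⊖_ (ℕP.m+[n∸m]≡n k≤) (ℕP.+-comm k m) ⟩
  (m ℕ.+ m) ⊖ (m ℕ.+ k)                     ≡⟨ ℤP.+-cancelˡ-⊖ m m k ⟩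
  m ⊖ k                                     ∎
  where open ≡-Reasoning

module _ (G : Graph) (n : ℕ) where

  private
    Tup : Set
    Tup = Tuple G n

  -- SameOrbit and the equal-or-adjacent relation of ReducedPower, wrapped so that their
  -- endpoints can be inferred.
  infix 4 _≃_ _∼_

  record _≃_ (x y : Tup) : Set where
    constructor orbit
    field
      perm     : Permutation′ n
      permutes : ∀ i → x (perm ⟨$⟩ʳ i) ≡ y i

  data _∼_ (x y : Tup) : Set where
    same     : x ≃ y → x ∼ y
    adjacent : ∀ {x' y'} → x ≃ x' → y ≃ y' → PowAdj G n x' y' → x ∼ y

  ≃⇒SameOrbit : ∀ {x y} → x ≃ y → SameOrbit G n x y
  ≃⇒SameOrbit (orbit π p) = π , p

  SameOrbit⇒≃ : ∀ {x y} → SameOrbit G n x y → x ≃ y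
  SameOrbit⇒≃ (π , p) = orbit π p

  ∼⇒EA : ∀ {x y} → x ∼ y → Target.EA (ReducedPower G n) x y
  ∼⇒EA (same x≃y) = inj₁ (≃⇒SameOrbit x≃y)
  ∼⇒EA (adjacent x≃x' y≃y' adj) = inj₂ (_ , _ , ≃⇒SameOrbit x≃x' , ≃⇒SameOrbit y≃y' , adj)

  EA⇒∼ : ∀ {x y} → Target.EA (ReducedPower G n) x y → x ∼ y
  EA⇒∼ (inj₁ x≃y) = same (SameOrbit⇒≃ x≃y)
  EA⇒∼ (inj₂ (_ , _ , x≃x' , y≃y' , adj)) = adjacent (SameOrbit⇒≃ x≃x') (SameOrbit⇒≃ y≃y') adj

  ≗⇒≃ : ∀ {x y} → x ≗ y → x ≃ y
  ≗⇒≃ = orbit idₚ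

  ≃-refl : ∀ {x} → x ≃ x
  ≃-refl = ≗⇒≃ λ _ → refl

  ≃-sym : ∀ {x y} → x ≃ y → y ≃ x
  ≃-sym {x} (orbit π p) = orbit (flip π) λ i → trans (sym (p (π ⟨$⟩ˡ i))) (cong x (inverseʳ π))

  ≃-trans : ∀ {x y z} → x ≃ y → y ≃ z → x ≃ z
  ≃-trans (orbit π p) (orbit ρ q) = orbit (ρ ∘ₚ π) λ i → trans (p (ρ ⟨$⟩ʳ i)) (q i)

  permute-≃ : ∀ (x : Tup) π → (λ i → x (π ⟨$⟩ʳ i)) ≃ x
  permute-≃ x π = ≃-sym (orbit π λ _ → refl)

  ∼-refl : ∀ {x} → x ∼ x
  ∼-refl = same ≃-refl

  ≗⇒∼ : ∀ {x y} → x ≗ y → x ∼ y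
  ≗⇒∼ x≗y = same (≗⇒≃ x≗y)

  ∼-sym : ∀ {x y} → x ∼ y → y ∼ x
  ∼-sym (same x≃y) = same (≃-sym x≃y)
  ∼-sym (adjacent x≃x' y≃y' (k , adj , eqs)) =
    adjacent y≃y' x≃x' (k , Graph.sym G adj , λ j j≢k → sym (eqs j j≢k))

  ∼-resp-≃ : ∀ {x x' y y'} → x ≃ x' → y ≃ y' → x ∼ y → x' ∼ y'
  ∼-resp-≃ x≃x' y≃y' (same x≃y) = same (≃-trans (≃-sym x≃x') (≃-trans x≃y y≃y'))
  ∼-resp-≃ x≃x' y≃y' (adjacent x≃a y≃b adj) =
    adjacent (≃-trans (≃-sym x≃x') x≃a) (≃-trans (≃-sym y≃y') y≃b) adj

  PowAdj⇒∼ : ∀ {x y} → PowAdj G n x y → x ∼ y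
  PowAdj⇒∼ = adjacent ≃-refl ≃-refl

  permute-injective : ∀ (π : Permutation′ n) {i j} → π ⟨$⟩ʳ i ≡ π ⟨$⟩ʳ j → i ≡ j
  permute-injective π {i} {j} e = trans (sym (inverseˡ π {i})) (trans (cong (π ⟨$⟩ˡ_) e) (inverseˡ π {j}))

  infixl 6 _[_]≔_

  _[_]≔_ : Tup → Fin n → V G → Tup
  s [ k ]≔ w = updateAt s k (const w)

  []≔-updates : ∀ s k w → (s [ k ]≔ w) k ≡ w
  []≔-updates s k w = updateAt-updates k s

  []≔-minimal : ∀ s k w {j} → j ≢ k → (s [ k ]≔ w) j ≡ s j
  []≔-minimal s k w {j} = updateAt-minimal j k s

  []≔-cong : ∀ {s s'} k w → s ≗ s' → s [ k ]≔ w ≗ s' [ k ]≔ w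
  []≔-cong {s} {s'} k w s≗s' j with j ≟ k
  ... | yes refl = trans ([]≔-updates s k w) (sym ([]≔-updates s' k w))
  ... | no j≢k = trans ([]≔-minimal s k w j≢k) (trans (s≗s' j) (sym ([]≔-minimal s' k w j≢k)))

  []≔-revert : ∀ s k w → s [ k ]≔ w [ k ]≔ s k ≗ s
  []≔-revert s k w j with j ≟ k
  ... | yes refl = []≔-updates _ j (s j)
  ... | no j≢k = trans ([]≔-minimal _ k _ j≢k) ([]≔-minimal s k w j≢k)

  []≔-permute : ∀ s (π : Permutation′ n) k w →
                (λ j → s (π ⟨$⟩ʳ j)) [ k ]≔ w ≗ (λ j → (s [ π ⟨$⟩ʳ k ]≔ w) (π ⟨$⟩ʳ j))
  []≔-permute s π k w j with j ≟ k
  ... | yes refl = trans ([]≔-updates _ j w) (sym ([]≔-updates s (π ⟨$⟩ʳ j) w))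
  ... | no j≢k = trans ([]≔-minimal _ k w j≢k)
                   (sym ([]≔-minimal s (π ⟨$⟩ʳ k) w (λ e → j≢k (permute-injective π e))))

  []≔-PowAdj : ∀ s k w → Adj G (s k) w → PowAdj G n s (s [ k ]≔ w)
  []≔-PowAdj s k w adj =
    k , subst (Adj G (s k)) (sym ([]≔-updates s k w)) adj , λ j j≢k → sym ([]≔-minimal s k w j≢k)

  -- Move lists

  data Move : Set where
    idle    : Move
    move    : Fin n → V G → Move
    permute : Permutation′ n → Move
    jump    : Tup → Move

  apply : Tup → Move → Tup
  apply s idle       = s
  apply s (move k w) = s [ k ]≔ w
  apply s (permute π) = λ j → s (π ⟨$⟩ʳ j)
  apply s (jump y)   = y

  Legal : Tup → Move → Set
  Legal s idle        = ⊤
  Legal s (move k w)  = Adj G (s k) w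
  Legal s (permute π) = ⊤
  Legal s (jump y)    = s ∼ y

  Valid : Tup → List Move → Set
  Valid s []      = ⊤
  Valid s (e ∷ L) = Legal s e × Valid (apply s e) L

  stateAt : Tup → List Move → ℕ → Tup
  stateAt s []      t       = s
  stateAt s (e ∷ L) zero    = s
  stateAt s (e ∷ L) (suc t) = stateAt (apply s e) L t

  final : Tup → List Move → Tup
  final s []      = s
  final s (e ∷ L) = final (apply s e) L

  stateAt-zero : ∀ s L → stateAt s L 0 ≡ s
  stateAt-zero s []      = refl
  stateAt-zero s (e ∷ L) = refl

  legal-∼ : ∀ s e → Legal s e → s ∼ apply s e
  legal-∼ s idle        _   = ∼-refl
  legal-∼ s (move k w)  adj = PowAdj⇒∼ ([]≔-PowAdj s k w adj)
  legal-∼ s (permute π) _   = same (orbit π λ _ → refl)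
  legal-∼ s (jump y)    s∼y = s∼y

  valid-∼ : ∀ s L → Valid s L → ∀ t → stateAt s L t ∼ stateAt s L (suc t)
  valid-∼ s []           _       t       = ∼-refl
  valid-∼ s (e ∷ [])     (l , _) zero    = legal-∼ s e l
  valid-∼ s (e ∷ f ∷ L)  (l , _) zero    = legal-∼ s e l
  valid-∼ s (e ∷ L)      (_ , v) (suc t) = valid-∼ (apply s e) L v t

  apply-cong : ∀ {s s'} e → s ≗ s' → apply s e ≗ apply s' e
  apply-cong idle        s≗s' = s≗s'
  apply-cong (move k w)  s≗s' = []≔-cong k w s≗s'
  apply-cong (permute π) s≗s' j = s≗s' (π ⟨$⟩ʳ j)
  apply-cong (jump y)    s≗s' j = refl

  legal-cong : ∀ {s s'} e → s ≗ s' → Legal s e → Legal s' e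
  legal-cong idle        s≗s' _ = tt
  legal-cong (move k w)  s≗s' adj = subst (λ z → Adj G z w) (s≗s' k) adj
  legal-cong (permute π) s≗s' _ = tt
  legal-cong (jump y)    s≗s' s∼y = ∼-resp-≃ (≗⇒≃ s≗s') ≃-refl s∼y

  valid-cong : ∀ {s s'} L → s ≗ s' → Valid s L → Valid s' L
  valid-cong []      s≗s' _       = tt
  valid-cong (e ∷ L) s≗s' (l , v) = legal-cong e s≗s' l , valid-cong L (apply-cong e s≗s') v

  stateAt-cong : ∀ {s s'} L → s ≗ s' → ∀ t → stateAt s L t ≗ stateAt s' L t
  stateAt-cong []      s≗s' t       = s≗s'
  stateAt-cong (e ∷ L) s≗s' zero    = s≗s'
  stateAt-cong (e ∷ L) s≗s' (suc t) = stateAt-cong L (apply-cong e s≗s') t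

  final-cong : ∀ {s s'} L → s ≗ s' → final s L ≗ final s' L
  final-cong []      s≗s' = s≗s'
  final-cong (e ∷ L) s≗s' = final-cong L (apply-cong e s≗s')

  final-++ : ∀ s P Q → final s (P ++ Q) ≡ final (final s P) Q
  final-++ s []      Q = refl
  final-++ s (e ∷ P) Q = final-++ (apply s e) P Q

  valid-++ : ∀ s P Q → Valid s P → Valid (final s P) Q → Valid s (P ++ Q)
  valid-++ s []      Q _       vQ = vQ
  valid-++ s (e ∷ P) Q (l , vP) vQ = l , valid-++ (apply s e) P Q vP vQ

  valid-++ˡ : ∀ s P Q → Valid s (P ++ Q) → Valid s P
  valid-++ˡ s []      Q _       = tt
  valid-++ˡ s (e ∷ P) Q (l , v) = l , valid-++ˡ (apply s e) P Q v

  valid-++ʳ : ∀ s P Q → Valid s (P ++ Q) → Valid (final s P) Q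
  valid-++ʳ s []      Q v       = v
  valid-++ʳ s (e ∷ P) Q (_ , v) = valid-++ʳ (apply s e) P Q v

  -- Homotopies of move lists

  -- Each rule moves the realised path by one column of a homotopy (see Deformation); idles keep
  -- both sides of a rule equally long.
  data Elementary (s : Tup) : List Move → List Move → Set where
    idle-intro    : Elementary s [] (idle ∷ [])
    move-swap     : ∀ {k l w u} → k ≢ l →
                    Elementary s (move k w ∷ move l u ∷ idle ∷ []) (idle ∷ move l u ∷ move k w ∷ [])
    move-cancel   : ∀ {k w v} → s k ≡ v → Elementary s (move k w ∷ move k v ∷ []) (idle ∷ idle ∷ [])
    permute-move  : ∀ {π k w} → Elementary s (permute π ∷ move k w ∷ []) (move (π ⟨$⟩ʳ k) w ∷ permute π ∷ [])
    permute-idle  : ∀ {π} → Elementary s (permute π ∷ idle ∷ []) (idle ∷ permute π ∷ [])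
    permute-fixed : ∀ {π} → (∀ j → s (π ⟨$⟩ʳ j) ≡ s j) → Elementary s (permute π ∷ []) (idle ∷ [])
    jump-split    : ∀ {y e π} → Legal s e → (∀ j → apply s e (π ⟨$⟩ʳ j) ≡ y j) →
                    Elementary s (jump y ∷ idle ∷ []) (e ∷ permute π ∷ [])

  record Deformation (s : Tup) (X Y : List Move) : Set where
    field
      rows-∼  : ∀ t → stateAt s X t ∼ stateAt s Y t
      final-≗ : final s X ≗ final s Y
      target-valid : Valid s Y

  open Deformation

  elementary-deformation : ∀ {s L L'} → Elementary s L L' → ∀ B → Valid s (L ++ B) → Deformation s (L ++ B) (L' ++ B)
  elementary-deformation {s} idle-intro B vB = record
    { rows-∼  = λ { zero → ≗⇒∼ λ j → cong (λ z → z j) (stateAt-zero s B) ; (suc t) → ∼-sym (valid-∼ s B vB t) }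
    ; final-≗ = λ _ → refl
    ; target-valid = tt , vB }
  elementary-deformation {s} (move-swap {k} {l} {w} {u} k≢l) B (adj₁ , adj₂ , _ , vB) = record
    { rows-∼  = λ { zero → ∼-refl
                  ; (suc zero) → ∼-sym (legal-∼ s (move k w) adj₁)
                  ; (suc (suc zero)) → ∼-resp-≃ (≗⇒≃ (λ j → sym (commute j))) ≃-refl
                                         (∼-sym (legal-∼ (s [ l ]≔ u) (move k w) adj₁′))
                  ; (suc (suc (suc t))) → ≗⇒∼ (stateAt-cong B commute t) }
    ; final-≗ = final-cong B commute
    ; target-valid = tt , adj₂′ , adj₁′ , valid-cong B commute vB }
    where
      commute : s [ k ]≔ w [ l ]≔ u ≗ s [ l ]≔ u [ k ]≔ w
      commute = updateAt-commutes l k (λ e → k≢l (sym e)) s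
      adj₂′ : Adj G (s l) u
      adj₂′ = subst (λ z → Adj G z u) ([]≔-minimal s k w (λ e → k≢l (sym e))) adj₂
      adj₁′ : Adj G ((s [ l ]≔ u) k) w
      adj₁′ = subst (λ z → Adj G z w) (sym ([]≔-minimal s l u k≢l)) adj₁
  elementary-deformation {s} (move-cancel {k} {w} refl) B (adj , _ , vB) = record
    { rows-∼  = λ { zero → ∼-refl
                  ; (suc zero) → ∼-sym (legal-∼ s (move k w) adj)
                  ; (suc (suc t)) → ≗⇒∼ (stateAt-cong B ([]≔-revert s k w) t) }
    ; final-≗ = final-cong B ([]≔-revert s k w)
    ; target-valid = tt , tt , valid-cong B ([]≔-revert s k w) vB }
  elementary-deformation {s} (permute-move {π} {k} {w}) B (_ , adj , vB) = record
    { rows-∼  = λ { zero → ∼-refl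
                  ; (suc zero) → adjacent (permute-≃ s π) ≃-refl ([]≔-PowAdj s (π ⟨$⟩ʳ k) w adj)
                  ; (suc (suc t)) → ≗⇒∼ (stateAt-cong B ([]≔-permute s π k w) t) }
    ; final-≗ = final-cong B ([]≔-permute s π k w)
    ; target-valid = adj , tt , valid-cong B ([]≔-permute s π k w) vB }
  elementary-deformation {s} (permute-idle {π}) B (_ , _ , vB) = record
    { rows-∼  = λ { zero → ∼-refl ; (suc zero) → same (permute-≃ s π) ; (suc (suc t)) → ∼-refl }
    ; final-≗ = λ _ → refl
    ; target-valid = tt , tt , vB }
  elementary-deformation {s} (permute-fixed fixed) B (_ , vB) = record
    { rows-∼  = λ { zero → ∼-refl ; (suc t) → ≗⇒∼ (stateAt-cong B fixed t) }
    ; final-≗ = final-cong B fixed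
    ; target-valid = tt , valid-cong B fixed vB }
  elementary-deformation {s} (jump-split {π = π} l splits) B (_ , _ , vB) = record
    { rows-∼  = λ { zero → ∼-refl
                  ; (suc zero) → same (≃-sym (orbit π splits))
                  ; (suc (suc t)) → ≗⇒∼ (stateAt-cong B (λ j → sym (splits j)) t) }
    ; final-≗ = final-cong B (λ j → sym (splits j))
    ; target-valid = l , tt , valid-cong B (λ j → sym (splits j)) vB }

  deformation-prefix : ∀ s P {X Y} → Valid s P → Deformation (final s P) X Y → Deformation s (P ++ X) (P ++ Y)
  deformation-prefix s []      vP       d = d
  deformation-prefix s (e ∷ P) (l , vP) d = record
    { rows-∼  = λ { zero → ∼-refl ; (suc t) → rows-∼ d′ t }
    ; final-≗ = final-≗ d′
    ; target-valid = l , target-valid d′ }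
    where d′ = deformation-prefix (apply s e) P vP d

  record Rewrite (s : Tup) (X Y : List Move) : Set where
    constructor rewrite-at
    field
      prefix suffix lhs rhs : List Move
      X≡ : X ≡ prefix ++ lhs ++ suffix
      Y≡ : Y ≡ prefix ++ rhs ++ suffix
      elementary : Elementary (final s prefix) lhs rhs
      source-valid : Valid s X

  rewrite-deformation : ∀ {s X Y} → Rewrite s X Y → Deformation s X Y
  rewrite-deformation {s} (rewrite-at P B L L' refl refl r v) =
    deformation-prefix s P (valid-++ˡ s P _ v) (elementary-deformation r B (valid-++ʳ s P _ v))

  Rewrite± : Tup → List Move → List Move → Set
  Rewrite± s X Y = Rewrite s X Y ⊎ Rewrite s Y X

  Homotopic : Tup → List Move → List Move → Set
  Homotopic s = Star (Rewrite± s)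

  rewrite±-rows : ∀ {s X Y} → Rewrite± s X Y → ∀ t → stateAt s X t ∼ stateAt s Y t
  rewrite±-rows (inj₁ r) t = rows-∼ (rewrite-deformation r) t
  rewrite±-rows (inj₂ r) t = ∼-sym (rows-∼ (rewrite-deformation r) t)

  rewrite±-final : ∀ {s X Y} → Rewrite± s X Y → final s X ≗ final s Y
  rewrite±-final (inj₁ r) = final-≗ (rewrite-deformation r)
  rewrite±-final (inj₂ r) j = sym (final-≗ (rewrite-deformation r) j)

  rewrite±-valid : ∀ {s X Y} → Rewrite± s X Y → Valid s X → Valid s Y
  rewrite±-valid (inj₁ r) _ = target-valid (rewrite-deformation r)
  rewrite±-valid (inj₂ r) _ = Rewrite.source-valid r

  homotopic-final : ∀ {s X Y} → Homotopic s X Y → final s X ≗ final s Y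
  homotopic-final ε _ = refl
  homotopic-final (r ◅ h) j = trans (rewrite±-final r j) (homotopic-final h j)

  homotopic-valid : ∀ {s X Y} → Homotopic s X Y → Valid s X → Valid s Y
  homotopic-valid ε v = v
  homotopic-valid (r ◅ h) v = homotopic-valid h (rewrite±-valid r v)

  homotopic-sym : ∀ {s X Y} → Homotopic s X Y → Homotopic s Y X
  homotopic-sym = reverse swap
    where
      swap : ∀ {s X Y} → Rewrite± s X Y → Rewrite± s Y X
      swap (inj₁ r) = inj₂ r
      swap (inj₂ r) = inj₁ r

  ≡⇒homotopic : ∀ {s X Y} → X ≡ Y → Homotopic s X Y
  ≡⇒homotopic refl = ε

  rewrite-prefix : ∀ {s P X Y} → Valid s P → Rewrite (final s P) X Y → Rewrite s (P ++ X) (P ++ Y)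
  rewrite-prefix {s} {P} vP (rewrite-at Q B L L' refl refl r v) =
    rewrite-at (P ++ Q) B L L' (sym (++-assoc P Q _)) (sym (++-assoc P Q _))
      (subst (λ z → Elementary z L L') (sym (final-++ s P Q)) r) (valid-++ s P _ vP v)

  rewrite-suffix : ∀ {s X Y B} → Rewrite s X Y → Valid (final s X) B → Rewrite s (X ++ B) (Y ++ B)
  rewrite-suffix {s} {B = B} (rewrite-at P Q L L' refl refl r v) vB =
    rewrite-at P (Q ++ B) L L' (reassoc L) (reassoc L') r (valid-++ s _ B v vB)
    where
      reassoc : ∀ M → (P ++ M ++ Q) ++ B ≡ P ++ M ++ Q ++ B
      reassoc M = trans (++-assoc P (M ++ Q) B) (cong (P ++_) (++-assoc M Q B))

  homotopic-prefix : ∀ {s P X Y} → Valid s P → Homotopic (final s P) X Y → Homotopic s (P ++ X) (P ++ Y)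
  homotopic-prefix vP ε = ε
  homotopic-prefix vP (inj₁ r ◅ h) = inj₁ (rewrite-prefix vP r) ◅ homotopic-prefix vP h
  homotopic-prefix vP (inj₂ r ◅ h) = inj₂ (rewrite-prefix vP r) ◅ homotopic-prefix vP h

  homotopic-suffix : ∀ {s X Y B} → Homotopic s X Y → Valid s X → Valid (final s X) B → Homotopic s (X ++ B) (Y ++ B)
  homotopic-suffix ε vX vB = ε
  homotopic-suffix {s} {X} {B = B} (_◅_ {j = X′} r h) vX vB =
    suffixed r ◅ homotopic-suffix h (rewrite±-valid r vX) vB′
    where
      vB′ : Valid (final s X′) B
      vB′ = valid-cong B (rewrite±-final r) vB
      suffixed : Rewrite± s X X′ → Rewrite± s (X ++ B) (X′ ++ B)
      suffixed (inj₁ r) = inj₁ (rewrite-suffix r vB)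
      suffixed (inj₂ r) = inj₂ (rewrite-suffix r vB′)

  elementary-cong : ∀ {s s' L L'} → s ≗ s' → Elementary s L L' → Elementary s' L L'
  elementary-cong s≗s' idle-intro = idle-intro
  elementary-cong s≗s' (move-swap k≢l) = move-swap k≢l
  elementary-cong s≗s' (move-cancel {k} e) = move-cancel (trans (sym (s≗s' k)) e)
  elementary-cong s≗s' permute-move = permute-move
  elementary-cong s≗s' permute-idle = permute-idle
  elementary-cong s≗s' (permute-fixed {π} fixed) =
    permute-fixed λ j → trans (sym (s≗s' (π ⟨$⟩ʳ j))) (trans (fixed j) (s≗s' j))
  elementary-cong s≗s' (jump-split {e = e} {π} l splits) =
    jump-split (legal-cong e s≗s' l) λ j → trans (sym (apply-cong e s≗s' (π ⟨$⟩ʳ j))) (splits j)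

  homotopic-cong : ∀ {s s' X Y} → s ≗ s' → Homotopic s X Y → Homotopic s' X Y
  homotopic-cong s≗s' ε = ε
  homotopic-cong {s} {s'} s≗s' (r ◅ h) = cong-rewrite± r ◅ homotopic-cong s≗s' h
    where
      cong-rewrite : ∀ {X Y} → Rewrite s X Y → Rewrite s' X Y
      cong-rewrite (rewrite-at P B L L' X≡ Y≡ r v) =
        rewrite-at P B L L' X≡ Y≡ (elementary-cong (final-cong P s≗s') r) (valid-cong _ s≗s' v)
      cong-rewrite± : ∀ {X Y} → Rewrite± s X Y → Rewrite± s' X Y
      cong-rewrite± (inj₁ r) = inj₁ (cong-rewrite r)
      cong-rewrite± (inj₂ r) = inj₂ (cong-rewrite r)

  HomotopicIfValid : Tup → List Move → List Move → Set
  HomotopicIfValid s X Y = Valid s X → Homotopic s X Y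

  infixr 4 _⟫_

  _⟫_ : ∀ {s X Y Z} → HomotopicIfValid s X Y → HomotopicIfValid s Y Z → HomotopicIfValid s X Z
  (f ⟫ g) v = let h = f v in h ◅◅ g (homotopic-valid h v)

  unconditionally : ∀ {s X Y} → Homotopic s X Y → HomotopicIfValid s X Y
  unconditionally h _ = h

  by-≡ : ∀ {s X Y} → X ≡ Y → HomotopicIfValid s X Y
  by-≡ X≡Y _ = ≡⇒homotopic X≡Y

  under-prefix : ∀ {s} P {X Y} → HomotopicIfValid (final s P) X Y → HomotopicIfValid s (P ++ X) (P ++ Y)
  under-prefix {s} P f v = homotopic-prefix (valid-++ˡ s P _ v) (f (valid-++ʳ s P _ v))

  under-suffix : ∀ {s X Y} B → HomotopicIfValid s X Y → HomotopicIfValid s (X ++ B) (Y ++ B)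
  under-suffix {s} {X} B f v = homotopic-suffix (f vX) vX (valid-++ʳ s X B v)
    where vX = valid-++ˡ s X B v

  elementary-step : ∀ {s} P L L' B → Elementary (final s P) L L' → HomotopicIfValid s (P ++ L ++ B) (P ++ L' ++ B)
  elementary-step P L L' B r v = inj₁ (rewrite-at P B L L' refl refl r v) ◅ ε

  idle-insert : ∀ {s} P Q → HomotopicIfValid s (P ++ Q) (P ++ idle ∷ Q)
  idle-insert P Q = elementary-step P [] (idle ∷ []) Q idle-intro

  idle-delete : ∀ {s} P Q → HomotopicIfValid s (P ++ idle ∷ Q) (P ++ Q)
  idle-delete {s} P Q v = homotopic-sym (idle-insert P Q (valid-++ s P Q vP vQ))
    where
      vP = valid-++ˡ s P _ v
      vQ = proj₂ (valid-++ʳ s P _ v)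

  idles-delete : ∀ {s} m L → HomotopicIfValid s (replicate m idle ++ L) L
  idles-delete zero    L = λ _ → ε
  idles-delete (suc m) L = idle-delete [] (replicate m idle ++ L) ⟫ idles-delete m L

  idles-valid : ∀ s m L → Valid s L → Valid s (replicate m idle ++ L)
  idles-valid s zero    L v = v
  idles-valid s (suc m) L v = tt , idles-valid s m L v

  idles-final : ∀ s m L → final s (replicate m idle ++ L) ≡ final s L
  idles-final s zero    L = refl
  idles-final s (suc m) L = idles-final s m L

  data Plain : List Move → Set where
    []     : Plain []
    idle∷_ : ∀ {L} → Plain L → Plain (idle ∷ L)
    move∷_ : ∀ {k w L} → Plain L → Plain (move k w ∷ L)

  data Solo (k : Fin n) : List Move → Set where
    []     : Solo k []
    idle∷_ : ∀ {L} → Solo k L → Solo k (idle ∷ L)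
    move∷_ : ∀ {w L} → Solo k L → Solo k (move k w ∷ L)

  data Within (ks : List (Fin n)) : List Move → Set where
    []        : Within ks []
    idle∷_    : ∀ {L} → Within ks L → Within ks (idle ∷ L)
    move[_]∷_ : ∀ {j w L} → j ∈ ks → Within ks L → Within ks (move j w ∷ L)

  plain-++ : ∀ {P Q} → Plain P → Plain Q → Plain (P ++ Q)
  plain-++ []        q = q
  plain-++ (idle∷ p) q = idle∷ plain-++ p q
  plain-++ (move∷ p) q = move∷ plain-++ p q

  ∼-move : ∀ {s x y} → s ≃ x → x ∼ y → ∃ λ e → Plain (e ∷ []) × Legal s e × apply s e ≃ y
  ∼-move s≃x (same x≃y) = idle , idle∷ [] , tt , ≃-trans s≃x x≃y
  ∼-move {s} s≃x (adjacent {y' = y'} x≃x' y≃y' (k , adj , others)) with ≃-trans s≃x x≃x'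
  ... | orbit π s≡x' = move (π ⟨$⟩ʳ k) (y' k) , move∷ [] , adj′ , ≃-trans (orbit π moved) (≃-sym y≃y')
    where
      adj′ : Adj G (s (π ⟨$⟩ʳ k)) (y' k)
      adj′ = subst (λ z → Adj G z (y' k)) (sym (s≡x' k)) adj
      moved : ∀ i → (s [ π ⟨$⟩ʳ k ]≔ y' k) (π ⟨$⟩ʳ i) ≡ y' i
      moved i with i ≟ k
      ... | yes refl = []≔-updates s (π ⟨$⟩ʳ i) (y' i)
      ... | no i≢k   = trans ([]≔-minimal s (π ⟨$⟩ʳ k) (y' k) (λ e → i≢k (permute-injective π e)))
                             (trans (s≡x' i) (others i i≢k))

  solo⇒plain : ∀ {k M} → Solo k M → Plain M
  solo⇒plain []        = []
  solo⇒plain (idle∷ t) = idle∷ solo⇒plain t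
  solo⇒plain (move∷ t) = move∷ solo⇒plain t

  within⇒plain : ∀ {ks M} → Within ks M → Plain M
  within⇒plain []             = []
  within⇒plain (idle∷ t)      = idle∷ within⇒plain t
  within⇒plain (move[ _ ]∷ t) = move∷ within⇒plain t

  plain⇒within : ∀ {M} → Plain M → Within (allFin n) M
  plain⇒within []                 = []
  plain⇒within (idle∷ p)          = idle∷ plain⇒within p
  plain⇒within (move∷_ {k} p)     = move[ ∈-allFin k ]∷ plain⇒within p

  solo-past : ∀ {s} l u k F → k ≢ l → Solo k F → HomotopicIfValid s (move l u ∷ F) (F ++ move l u ∷ [])
  solo-past l u k []               k≢l []        = λ _ → ε
  solo-past l u k (idle ∷ F)       k≢l (idle∷ t) =
    idle-delete (move l u ∷ []) F ⟫ idle-insert [] (move l u ∷ F)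
    ⟫ under-prefix (idle ∷ []) (solo-past l u k F k≢l t)
  solo-past l u k (move .k w ∷ F) k≢l (move∷ t) =
    idle-insert (move l u ∷ move k w ∷ []) F
    ⟫ elementary-step [] (move l u ∷ move k w ∷ idle ∷ []) (idle ∷ move k w ∷ move l u ∷ []) F
        (move-swap (λ e → k≢l (sym e)))
    ⟫ idle-delete [] (move k w ∷ move l u ∷ F)
    ⟫ under-prefix (move k w ∷ []) (solo-past l u k F k≢l t)

  solos-commute : ∀ {s} l k P F → k ≢ l → Solo l P → Solo k F → HomotopicIfValid s (P ++ F) (F ++ P)
  solos-commute l k []               F k≢l []        tF = by-≡ (sym (++-identityʳ F))
  solos-commute l k (idle ∷ P)       F k≢l (idle∷ tP) tF =
    idle-delete [] (P ++ F) ⟫ solos-commute l k P F k≢l tP tF ⟫ idle-insert F P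
  solos-commute l k (move .l u ∷ P) F k≢l (move∷ tP) tF =
    under-prefix (move l u ∷ []) (solos-commute l k P F k≢l tP tF)
    ⟫ under-suffix P (solo-past l u k F k≢l tF)
    ⟫ by-≡ (++-assoc F (move l u ∷ []) P)

  -- undo and relabel are only meant for plain lists; they stop at the first permute or jump.
  undo : Tup → List Move → List Move
  undo s []            = []
  undo s (idle ∷ L)    = undo s L
  undo s (move k w ∷ L) = undo (s [ k ]≔ w) L ++ move k (s k) ∷ []
  undo s (permute π ∷ L) = []
  undo s (jump y ∷ L)  = []

  undo-plain : ∀ s L → Plain (undo s L)
  undo-plain s []             = []
  undo-plain s (idle ∷ L)     = undo-plain s L
  undo-plain s (move k w ∷ L) = plain-++ (undo-plain (s [ k ]≔ w) L) (move∷ [])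
  undo-plain s (permute π ∷ L) = []
  undo-plain s (jump y ∷ L)   = []

  undo-correct : ∀ s L → Plain L → Valid s L → Valid (final s L) (undo s L) × (final (final s L) (undo s L) ≗ s)
  undo-correct s []             []        _       = tt , λ _ → refl
  undo-correct s (idle ∷ L)     (idle∷ p) (_ , v) = undo-correct s L p v
  undo-correct s (move k w ∷ L) (move∷ p) (adj , v) with undo-correct (s [ k ]≔ w) L p v
  ... | vU , back = valid-++ _ (undo s′ L) (move k (s k) ∷ []) vU (adj′ , tt) , back′
    where
      s′ = s [ k ]≔ w
      adj′ : Adj G (final (final s′ L) (undo s′ L) k) (s k)
      adj′ = subst (λ z → Adj G z (s k)) (sym (trans (back k) ([]≔-updates s k w))) (Graph.sym G adj)
      back′ : final (final s′ L) (undo s′ L ++ move k (s k) ∷ []) ≗ s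
      back′ j = trans (cong (λ z → z j) (final-++ (final s′ L) (undo s′ L) (move k (s k) ∷ [])))
                  (trans ([]≔-cong k (s k) back j) ([]≔-revert s k w j))

  undo-cancels : ∀ {s} L → Plain L → HomotopicIfValid s (L ++ undo s L) []
  undo-cancels []             []        = λ _ → ε
  undo-cancels (idle ∷ L)     (idle∷ p) = idle-delete [] (L ++ undo _ L) ⟫ undo-cancels L p
  undo-cancels {s} (move k w ∷ L) (move∷ p) =
    by-≡ (cong (move k w ∷_) (sym (++-assoc L (undo (s [ k ]≔ w) L) (move k (s k) ∷ []))))
    ⟫ under-prefix (move k w ∷ []) (under-suffix (move k (s k) ∷ []) (undo-cancels L p))
    ⟫ elementary-step [] (move k w ∷ move k (s k) ∷ []) (idle ∷ idle ∷ []) [] (move-cancel refl)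
    ⟫ idle-delete [] (idle ∷ []) ⟫ idle-delete [] []

  relabel : Permutation′ n → List Move → List Move
  relabel π []              = []
  relabel π (idle ∷ L)      = idle ∷ relabel π L
  relabel π (move k w ∷ L)  = move (π ⟨$⟩ʳ k) w ∷ relabel π L
  relabel π (permute ρ ∷ L) = []
  relabel π (jump y ∷ L)    = []

  relabel-plain : ∀ π {L} → Plain L → Plain (relabel π L)
  relabel-plain π []        = []
  relabel-plain π (idle∷ p) = idle∷ relabel-plain π p
  relabel-plain π (move∷ p) = move∷ relabel-plain π p

  relabel-solo : ∀ {k} π {Q} → Solo k Q → Solo (π ⟨$⟩ʳ k) (relabel π Q)
  relabel-solo π []        = []
  relabel-solo π (idle∷ t) = idle∷ relabel-solo π t
  relabel-solo π (move∷ t) = move∷ relabel-solo π t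

  permute-past : ∀ {s} π L → Plain L → HomotopicIfValid s (permute π ∷ L) (relabel π L ++ permute π ∷ [])
  permute-past π []             []        = λ _ → ε
  permute-past π (idle ∷ L)     (idle∷ p) =
    elementary-step [] (permute π ∷ idle ∷ []) (idle ∷ permute π ∷ []) L permute-idle
    ⟫ under-prefix (idle ∷ []) (permute-past π L p)
  permute-past π (move k w ∷ L) (move∷ p) =
    elementary-step [] (permute π ∷ move k w ∷ []) (move (π ⟨$⟩ʳ k) w ∷ permute π ∷ []) L permute-move
    ⟫ under-prefix (move (π ⟨$⟩ʳ k) w ∷ []) (permute-past π L p)

  only : Fin n → List Move → List Move
  only k []               = []
  only k (idle ∷ L)       = only k L
  only k (move j w ∷ L) with j ≟ k
  ... | yes _ = move j w ∷ only k L
  ... | no _  = only k L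
  only k (permute π ∷ L)  = only k L
  only k (jump y ∷ L)     = only k L

  except : Fin n → List Move → List Move
  except k []              = []
  except k (idle ∷ L)      = except k L
  except k (move j w ∷ L) with j ≟ k
  ... | yes _ = except k L
  ... | no _  = move j w ∷ except k L
  except k (permute π ∷ L) = except k L
  except k (jump y ∷ L)    = except k L

  only-solo : ∀ k L → Solo k (only k L)
  only-solo k []              = []
  only-solo k (idle ∷ L)      = only-solo k L
  only-solo k (move j w ∷ L) with j ≟ k
  ... | yes refl = move∷ only-solo k L
  ... | no _     = only-solo k L
  only-solo k (permute π ∷ L) = only-solo k L
  only-solo k (jump y ∷ L)    = only-solo k L

  except-within : ∀ {k ks} M → Within (k ∷ ks) M → Within ks (except k M)
  except-within []             []                = []
  except-within (idle ∷ M)     (idle∷ t)         = except-within M t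
  except-within {k} (move j w ∷ M) (move[ j∈ ]∷ t) with j ≟ k
  ... | yes _ = except-within M t
  ... | no j≢k with j∈
  ...   | here j≡k  = ⊥-elim (j≢k j≡k)
  ...   | there j∈′ = move[ j∈′ ]∷ except-within M t

  separate : ∀ {s} k M → Plain M → HomotopicIfValid s M (only k M ++ except k M)
  separate k []             []        = λ _ → ε
  separate k (idle ∷ M)     (idle∷ p) = idle-delete [] M ⟫ separate k M p
  separate k (move j w ∷ M) (move∷ p) with j ≟ k
  ... | yes refl = under-prefix (move j w ∷ []) (separate k M p)
  ... | no j≢k   = under-prefix (move j w ∷ []) (separate k M p)
                 ⟫ under-suffix (except k M) (solo-past j w k (only k M) (λ e → j≢k (sym e)) (only-solo k M))
                 ⟫ by-≡ (++-assoc (only k M) (move j w ∷ []) (except k M))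

  within-[] : ∀ {s} M → Within [] M → HomotopicIfValid s M []
  within-[] []         []        = λ _ → ε
  within-[] (idle ∷ M) (idle∷ t) = idle-delete [] M ⟫ within-[] M t

  final-solo : ∀ {k} s F → Solo k F → ∀ {j} → j ≢ k → final s F j ≡ s j
  final-solo s []             []        j≢k = refl
  final-solo s (idle ∷ F)     (idle∷ t) j≢k = final-solo s F t j≢k
  final-solo {k} s (move .k w ∷ F) (move∷ t) j≢k = trans (final-solo (s [ k ]≔ w) F t j≢k) ([]≔-minimal s k w j≢k)

  final-at : ∀ {s s'} M → Plain M → ∀ k → s k ≡ s' k → final s M k ≡ final s' M k
  final-at []             []        k e = e
  final-at (idle ∷ M)     (idle∷ p) k e = final-at M p k e
  final-at {s} {s'} (move i w ∷ M) (move∷ p) k e = final-at M p k (updated-at k e)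
    where
      updated-at : ∀ j → s j ≡ s' j → (s [ i ]≔ w) j ≡ (s' [ i ]≔ w) j
      updated-at j sj≡s'j with j ≟ i
      ... | yes refl = trans ([]≔-updates s j w) (sym ([]≔-updates s' j w))
      ... | no j≢i   = trans ([]≔-minimal s i w j≢i) (trans sj≡s'j (sym ([]≔-minimal s' i w j≢i)))

  final-only : ∀ s k M → Plain M → final s (only k M) k ≡ final s M k
  final-only s k []             []        = refl
  final-only s k (idle ∷ M)     (idle∷ p) = final-only s k M p
  final-only s k (move j w ∷ M) (move∷ p) with j ≟ k
  ... | yes refl = final-only (s [ j ]≔ w) k M p
  ... | no j≢k   = trans (final-only s k M p) (final-at M p k (sym ([]≔-minimal s j w (λ e → j≢k (sym e)))))

  -- Move lists as maps ℤ → Gⁿ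

  row : Tup → List Move → ℤ → Tup
  row s L (+ t)    = stateAt s L t
  row s L -[1+ _ ] = s

  row-∼ : ∀ s L → Valid s L → ∀ z → row s L z ∼ row s L (z ℤ.+ 1ℤ)
  row-∼ s L v (+ t)          = subst (λ u → stateAt s L t ∼ stateAt s L u) (ℕP.+-comm 1 t) (valid-∼ s L v t)
  row-∼ s L v -[1+ zero ]    = ≗⇒∼ λ j → cong (λ z → z j) (sym (stateAt-zero s L))
  row-∼ s L v -[1+ suc _ ]   = ∼-refl

  row-rewrite : ∀ {s X Y} → Rewrite± s X Y → ∀ z → row s X z ∼ row s Y z
  row-rewrite r (+ t)    = rewrite±-rows r t
  row-rewrite r -[1+ _ ] = ∼-refl

  row-nonpositive : ∀ s L m → row s L (ℤ.- (+ m)) ≡ s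
  row-nonpositive s L zero    = stateAt-zero s L
  row-nonpositive s L (suc m) = refl

  stateAt-beyond : ∀ s L t → length L ≤ t → stateAt s L t ≡ final s L
  stateAt-beyond s []      t       _         = refl
  stateAt-beyond s (e ∷ L) (suc t) (s≤s le) = stateAt-beyond (apply s e) L t le

  stateAt-++ˡ : ∀ s A B t → t ≤ length A → stateAt s (A ++ B) t ≡ stateAt s A t
  stateAt-++ˡ s []      B zero    _         = stateAt-zero s B
  stateAt-++ˡ s (e ∷ A) B zero    _         = refl
  stateAt-++ˡ s (e ∷ A) B (suc t) (s≤s le) = stateAt-++ˡ (apply s e) A B t le

  stateAt-++ʳ : ∀ s A B u → stateAt s (A ++ B) (length A ℕ.+ u) ≡ stateAt (final s A) B u
  stateAt-++ʳ s []      B u = refl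
  stateAt-++ʳ s (e ∷ A) B u = stateAt-++ʳ (apply s e) A B u

  row-idles : ∀ s m L z → row s (replicate m idle ++ L) (z ℤ.+ + m) ≡ row s L z
  row-idles s zero    L z = cong (row s L) (ℤP.+-identityʳ z)
  row-idles s (suc m) L z = begin
    row s (idle ∷ replicate m idle ++ L) (z ℤ.+ + suc m)        ≡⟨ cong (row s (idle ∷ replicate m idle ++ L)) shift ⟩
    row s (idle ∷ replicate m idle ++ L) ((z ℤ.+ + m) ℤ.+ 1ℤ)  ≡⟨ drop-idle (z ℤ.+ + m) ⟩
    row s (replicate m idle ++ L) (z ℤ.+ + m)                   ≡⟨ row-idles s m L z ⟩
    row s L z                                                   ∎
    where
      open ≡-Reasoning
      shift : z ℤ.+ + suc m ≡ (z ℤ.+ + m) ℤ.+ 1ℤ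
      shift = trans (cong (λ q → z ℤ.+ q) (trans (cong +_ (ℕP.+-comm 1 m)) (ℤP.pos-+ m 1)))
                    (sym (ℤP.+-assoc z (+ m) 1ℤ))
      drop-idle : ∀ w → row s (idle ∷ replicate m idle ++ L) (w ℤ.+ 1ℤ) ≡ row s (replicate m idle ++ L) w
      drop-idle (+ t)           = cong (stateAt s (idle ∷ replicate m idle ++ L)) (ℕP.+-comm t 1)
      drop-idle -[1+ zero ]     = refl
      drop-idle -[1+ suc _ ]    = refl

  stage : ∀ {s X Y} → Homotopic s X Y → ℕ → List Move
  stage {X = X} ε       _       = X
  stage {X = X} (_ ◅ h) zero    = X
  stage         (_ ◅ h) (suc j) = stage h j

  stages : ∀ {s X Y} → Homotopic s X Y → ℕ
  stages ε       = 0
  stages (_ ◅ h) = suc (stages h)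

  stage-first : ∀ {s X Y} (h : Homotopic s X Y) → stage h 0 ≡ X
  stage-first ε       = refl
  stage-first (_ ◅ h) = refl

  stage-last : ∀ {s X Y} (h : Homotopic s X Y) → stage h (stages h) ≡ Y
  stage-last ε       = refl
  stage-last (_ ◅ h) = stage-last h

  stage-valid : ∀ {s X Y} (h : Homotopic s X Y) → Valid s X → ∀ j → Valid s (stage h j)
  stage-valid ε       v j       = v
  stage-valid (r ◅ h) v zero    = v
  stage-valid (r ◅ h) v (suc j) = stage-valid h (rewrite±-valid r v) j

  stage-final : ∀ {s X Y} (h : Homotopic s X Y) → ∀ j → final s (stage h j) ≗ final s X
  stage-final ε       j       _ = refl
  stage-final (r ◅ h) zero    _ = refl
  stage-final (r ◅ h) (suc j) i = trans (stage-final h j i) (sym (rewrite±-final r i))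

  stage-step : ∀ {s X Y} (h : Homotopic s X Y) → ∀ j → j ℕ.< stages h → Rewrite± s (stage h j) (stage h (suc j))
  stage-step (r ◅ h) zero    _         = subst (Rewrite± _ _) (sym (stage-first h)) r
  stage-step (r ◅ h) (suc j) (s≤s j<) = stage-step h j j<

  row-based : ∀ v L → final v L ≗ v → ∀ D i → D ℕ.+ length L ≤ ∣ i ∣ → row v L (i ℤ.+ + D) ≃ v
  row-based v L returns D (+ k) le =
    ≗⇒≃ λ j → trans (cong (λ z → z j) (stateAt-beyond v L (k ℕ.+ D) past)) (returns j)
    where
      past : length L ≤ k ℕ.+ D
      past = ℕP.≤-trans (ℕP.m+n≤o⇒n≤o D le) (ℕP.m≤m+n k D)
  row-based v L returns D -[1+ k ] le =
    ≗⇒≃ λ j → cong (λ z → z j)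
                (trans (cong (row v L) (ℤP.⊖-≤ (ℕP.m+n≤o⇒m≤o D le))) (row-nonpositive v L (suc k ℕ.∸ D)))

  homotopic⇒BasedHomotopy : ∀ {v X Y} → Homotopic v X Y → Valid v X → final v X ≗ v →
                            ∀ D (P Q : ℤ → Tup) →
                            (∀ i → row v X (i ℤ.+ + D) ≃ P i) → (∀ i → row v Y (i ℤ.+ + D) ≃ Q i) →
                            BasedHomotopy (ReducedPower G n) v P Q
  homotopic⇒BasedHomotopy {v} h vX returns D P Q starts ends = record
    { m         = stages h
    ; h         = λ i j → row v (stage h j) (i ℤ.+ + D)
    ; rows      = λ j _ i → ∼⇒EA (subst (λ z → row v (stage h j) (i ℤ.+ + D) ∼ row v (stage h j) z) (shift i)
                                    (row-∼ v (stage h j) (stage-valid h vX j) (i ℤ.+ + D)))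
    ; cols      = λ j j< i → ∼⇒EA (row-rewrite (stage-step h j j<) (i ℤ.+ + D))
    ; start     = λ i → ≃⇒SameOrbit (subst (λ L → row v L (i ℤ.+ + D) ≃ P i) (sym (stage-first h)) (starts i))
    ; end       = λ i → ≃⇒SameOrbit (subst (λ L → row v L (i ℤ.+ + D) ≃ Q i) (sym (stage-last h)) (ends i))
    ; rowsBased = λ j _ → D ℕ.+ length (stage h j) , λ i le →
        ≃⇒SameOrbit (row-based v (stage h j) (λ t → trans (stage-final h j t) (returns t)) D i le) }
    where
      shift : ∀ i → (i ℤ.+ + D) ℤ.+ 1ℤ ≡ (i ℤ.+ 1ℤ) ℤ.+ + D
      shift i = trans (ℤP.+-assoc i (+ D) 1ℤ)
                  (trans (cong (λ q → i ℤ.+ q) (ℤP.+-comm (+ D) 1ℤ)) (sym (ℤP.+-assoc i 1ℤ (+ D))))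

  transpose-sends : ∀ (k k' : Fin n) → transpose k k' ⟨$⟩ʳ k ≡ k'
  transpose-sends k k' with k ≟ k
  ... | yes _   = refl
  ... | no k≢k = ⊥-elim (k≢k refl)

  -- Loops at a gathered configuration

  module Gathering (a : V G) (other : (k : Fin n) → ∃ λ k' → k' ≢ k) where

    Gathered : Tup → Set
    Gathered s = ∀ j → s j ≡ a

    gathered-≗ : ∀ {s s'} → Gathered s → Gathered s' → s ≗ s'
    gathered-≗ gs gs' j = trans (gs j) (sym (gs' j))

    record GatheredLoop (Q : List Move) : Set where
      field
        valid-at : ∀ s → Gathered s → Valid s Q
        returns  : ∀ s → Gathered s → Gathered (final s Q)

    open GatheredLoop

    gathered-loop : ∀ {s₀ Q} → Gathered s₀ → Valid s₀ Q → Gathered (final s₀ Q) → GatheredLoop Q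
    gathered-loop {Q = Q} gs₀ v gf = record
      { valid-at = λ s gs → valid-cong Q (gathered-≗ gs₀ gs) v
      ; returns  = λ s gs j → trans (sym (final-cong Q (gathered-≗ gs₀ gs) j)) (gf j) }

    gatheredLoop-++ : ∀ {X Y} → GatheredLoop X → GatheredLoop Y → GatheredLoop (X ++ Y)
    gatheredLoop-++ {X} {Y} lX lY = record
      { valid-at = λ s gs → valid-++ s X Y (valid-at lX s gs) (valid-at lY _ (returns lX s gs))
      ; returns  = λ s gs j → trans (cong (λ z → z j) (final-++ s X Y)) (returns lY _ (returns lX s gs) j) }

    -- Relabelling is free at a gathered configuration: a permutation fixes it, so it can be
    -- introduced, pushed through Q, and removed again at the (gathered) end.
    relabel-homotopic : ∀ π Q → Plain Q → GatheredLoop Q → ∀ s → Gathered s → Homotopic s Q (relabel π Q)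
    relabel-homotopic π Q pQ lQ s gs = homotopy (valid-at lQ s gs)
      where
        fixed : ∀ j → s (π ⟨$⟩ʳ j) ≡ s j
        fixed j = trans (gs (π ⟨$⟩ʳ j)) (sym (gs j))
        vπQ : Valid s (permute π ∷ Q)
        vπQ = tt , valid-cong Q (λ j → sym (fixed j)) (valid-at lQ s gs)
        introduce : Homotopic s (idle ∷ Q) (permute π ∷ Q)
        introduce = homotopic-sym (elementary-step [] (permute π ∷ []) (idle ∷ []) Q (permute-fixed fixed) vπQ)
        pushed = permute-past π Q pQ vπQ
        t = final s (relabel π Q)
        tπ : ∀ j → t (π ⟨$⟩ʳ j) ≡ a
        tπ j = trans (sym (cong (λ z → z j) (final-++ s (relabel π Q) (permute π ∷ []))))
                 (trans (sym (homotopic-final pushed j))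
                   (trans (final-cong Q fixed j) (returns lQ s gs j)))
        t-gathered : Gathered t
        t-gathered j = trans (cong t (sym (inverseʳ π))) (tπ (π ⟨$⟩ˡ j))
        homotopy : HomotopicIfValid s Q (relabel π Q)
        homotopy = idle-insert [] Q ⟫ unconditionally introduce ⟫ unconditionally pushed
                   ⟫ elementary-step (relabel π Q) (permute π ∷ []) (idle ∷ []) []
                       (permute-fixed λ j → trans (tπ j) (sym (t-gathered j)))
                   ⟫ idle-delete (relabel π Q) [] ⟫ by-≡ (++-identityʳ (relabel π Q))

    only-gathered : ∀ {s} k M → Plain M → Gathered s → Gathered (final s M) → Gathered (final s (only k M))
    only-gathered {s} k M p gs gM j with j ≟ k
    ... | yes refl = trans (final-only s k M p) (gM j)
    ... | no j≢k   = trans (final-solo s (only k M) (only-solo k M) j≢k) (gs j)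

    solo-loops-commute : ∀ k k' P Q → Solo k P → Solo k' Q → GatheredLoop P → GatheredLoop Q →
                         ∀ s → Gathered s → Homotopic s (P ++ Q) (Q ++ P)
    solo-loops-commute k k' P Q tP tQ lP lQ s gs with k ≟ k'
    ... | no k≢k′  = solos-commute k k' P Q (λ e → k≢k′ (sym e)) tP tQ (valid-at (gatheredLoop-++ lP lQ) s gs)
    ... | yes refl = relabel-Q ◅◅ swap ◅◅ unrelabel-Q
      where
        π = transpose k (proj₁ (other k))
        Q′ = relabel π Q
        relabelled = relabel-homotopic π Q (solo⇒plain tQ) lQ s gs
        Q′-returns : Gathered (final s Q′)
        Q′-returns j = trans (sym (homotopic-final relabelled j)) (returns lQ s gs j)
        relabel-Q : Homotopic s (P ++ Q) (P ++ Q′)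
        relabel-Q = homotopic-prefix (valid-at lP s gs)
                      (relabel-homotopic π Q (solo⇒plain tQ) lQ (final s P) (returns lP s gs))
        swap : Homotopic s (P ++ Q′) (Q′ ++ P)
        swap = solos-commute k (proj₁ (other k)) P Q′ (proj₂ (other k)) tP
                 (subst (λ z → Solo z Q′) (transpose-sends k (proj₁ (other k))) (relabel-solo π tQ))
                 (homotopic-valid relabel-Q (valid-at (gatheredLoop-++ lP lQ) s gs))
        unrelabel-Q : Homotopic s (Q′ ++ P) (Q ++ P)
        unrelabel-Q = homotopic-suffix (homotopic-sym relabelled)
                        (homotopic-valid relabelled (valid-at lQ s gs)) (valid-at lP _ Q′-returns)

    CommutesWithSolos : List Move → Set
    CommutesWithSolos W = ∀ k P s → Solo k P → GatheredLoop P → Gathered s → Homotopic s (P ++ W) (W ++ P)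

    commutes-within : ∀ W → GatheredLoop W → CommutesWithSolos W → ∀ ks M → Within ks M → GatheredLoop M →
                      ∀ s → Gathered s → Homotopic s (M ++ W) (W ++ M)
    commutes-within W lW comm [] M tM lM s gs =
      (under-suffix W (within-[] M tM) ⟫ by-≡ (sym (++-identityʳ W))
       ⟫ under-prefix W (λ _ → homotopic-sym (within-[] M tM (valid-at lM _ (returns lW s gs)))))
      (valid-at (gatheredLoop-++ lM lW) s gs)
    commutes-within W lW comm (k ∷ ks) M tM lM s gs =
      (under-suffix W (separate k M pM) ⟫ by-≡ (++-assoc F R W)
       ⟫ under-prefix F (λ _ → commutes-within W lW comm ks R (except-within M tM) lR (final s F) gF)
       ⟫ by-≡ (sym (++-assoc F W R))
       ⟫ under-suffix R (λ _ → comm k F s (only-solo k M) lF gs)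
       ⟫ by-≡ (++-assoc W F R)
       ⟫ under-prefix W (λ _ → homotopic-sym (separate k M pM (valid-at lM _ (returns lW s gs)))))
      (valid-at (gatheredLoop-++ lM lW) s gs)
      where
        pM = within⇒plain tM
        F = only k M
        R = except k M
        separated = separate k M pM (valid-at lM s gs)
        vFR = homotopic-valid separated (valid-at lM s gs)
        gF : Gathered (final s F)
        gF = only-gathered k M pM gs (returns lM s gs)
        gR : Gathered (final (final s F) R)
        gR j = trans (sym (cong (λ z → z j) (final-++ s F R)))
                 (trans (sym (homotopic-final separated j)) (returns lM s gs j))
        lF = gathered-loop gs (valid-++ˡ s F R vFR) gF
        lR = gathered-loop gF (valid-++ʳ s F R vFR) gR

    gathered-loops-commute : ∀ M M' → Plain M → Plain M' → GatheredLoop M → GatheredLoop M' →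
                             ∀ s → Gathered s → Homotopic s (M ++ M') (M' ++ M)
    gathered-loops-commute M M' pM pM' lM lM' =
      commutes-within M' lM' comm-M' (allFin n) M (plain⇒within pM) lM
      where
        commutes-with-solo : ∀ k Q → Solo k Q → GatheredLoop Q → ∀ M → Plain M → GatheredLoop M →
                             ∀ s → Gathered s → Homotopic s (M ++ Q) (Q ++ M)
        commutes-with-solo k Q tQ lQ M pM lM =
          commutes-within Q lQ (λ k' P s tP lP gs → solo-loops-commute k' k P Q tP tQ lP lQ s gs)
            (allFin n) M (plain⇒within pM) lM
        comm-M' : CommutesWithSolos M'
        comm-M' k P s tP lP gs = homotopic-sym (commutes-with-solo k P tP lP M' pM' lM' s gs)

    module _ (connected : Connected G) (x₀ : Tup) where

      walk-moves : Fin n → ∀ {u v} → Star (Adj G) u v → List Move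
      walk-moves k ε = []
      walk-moves k (_◅_ {j = w} _ p) = move k w ∷ walk-moves k p

      walk-plain : ∀ k {u v} (p : Star (Adj G) u v) → Plain (walk-moves k p)
      walk-plain k ε       = []
      walk-plain k (_ ◅ p) = move∷ walk-plain k p

      walk-effect : ∀ s k {u v} (p : Star (Adj G) u v) → s k ≡ u →
                    Valid s (walk-moves k p) × final s (walk-moves k p) k ≡ v ×
                    (∀ {j} → j ≢ k → final s (walk-moves k p) j ≡ s j)
      walk-effect s k ε s≡u = tt , s≡u , λ _ → refl
      walk-effect s k (_◅_ {j = w} adj p) s≡u with walk-effect (s [ k ]≔ w) k p ([]≔-updates s k w)
      ... | v , arrives , others =
        (subst (λ z → Adj G z w) (sym s≡u) adj , v) , arrives , λ j≢k → trans (others j≢k) ([]≔-minimal s k w j≢k)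

      gather-token : Tup → Fin n → List Move
      gather-token s k = walk-moves k (connected (s k) a)

      gather : Tup → List (Fin n) → List Move
      gather s []       = []
      gather s (k ∷ ks) = gather-token s k ++ gather (final s (gather-token s k)) ks

      gather-plain : ∀ s ks → Plain (gather s ks)
      gather-plain s []       = []
      gather-plain s (k ∷ ks) = plain-++ (walk-plain k (connected (s k) a)) (gather-plain _ ks)

      gather-valid : ∀ s ks → Valid s (gather s ks)
      gather-valid s []       = tt
      gather-valid s (k ∷ ks) =
        valid-++ s (gather-token s k) _ (proj₁ (walk-effect s k (connected (s k) a) refl)) (gather-valid _ ks)

      gather-final : ∀ s ks j → j ∈ ks ⊎ s j ≡ a → final s (gather s ks) j ≡ a
      gather-final s []       j (inj₂ sj≡a) = sj≡a
      gather-final s (k ∷ ks) j j∈ =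
        trans (cong (λ z → z j) (final-++ s (gather-token s k) _)) (gather-final _ ks j (after-k j∈ (j ≟ k)))
        where
          effect = walk-effect s k (connected (s k) a) refl
          after-k : j ∈ k ∷ ks ⊎ s j ≡ a → Dec (j ≡ k) → j ∈ ks ⊎ final s (gather-token s k) j ≡ a
          after-k (inj₁ (there j∈ks)) _      = inj₁ j∈ks
          after-k _ (yes refl)               = inj₂ (proj₁ (proj₂ effect))
          after-k (inj₁ (here j≡k)) (no j≢k) = ⊥-elim (j≢k j≡k)
          after-k (inj₂ sj≡a) (no j≢k)       = inj₂ (trans (proj₂ (proj₂ effect) j≢k) sj≡a)

      C : List Move
      C = gather x₀ (allFin n)

      D : List Move
      D = undo x₀ C

      ŷ : Tup
      ŷ = final x₀ C

      C-plain : Plain C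
      C-plain = gather-plain x₀ (allFin n)

      C-valid : Valid x₀ C
      C-valid = gather-valid x₀ (allFin n)

      ŷ-gathered : Gathered ŷ
      ŷ-gathered j = gather-final x₀ (allFin n) j (inj₁ (∈-allFin j))

      D-valid : Valid ŷ D
      D-valid = proj₁ (undo-correct x₀ C C-plain C-valid)

      D-returns : final ŷ D ≗ x₀
      D-returns = proj₂ (undo-correct x₀ C C-plain C-valid)

      record MoveLoop (Λ : List Move) : Set where
        field
          valid-from-x₀ : Valid x₀ Λ
          closes        : final x₀ Λ ≗ x₀
          shape         : Plain Λ ⊎ ∃ λ L → Λ ≡ L ++ jump x₀ ∷ [] × Plain L

      open MoveLoop

      conjugate : List Move → List Move
      conjugate Λ = D ++ Λ ++ C

      conjugate-loop : ∀ {Λ} → MoveLoop Λ → GatheredLoop (conjugate Λ)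
      conjugate-loop {Λ} lΛ = gathered-loop ŷ-gathered valid-conj gathered-end
        where
          s₁ = final ŷ D
          closes₁ : final s₁ Λ ≗ x₀
          closes₁ j = trans (final-cong Λ D-returns j) (closes lΛ j)
          valid-conj : Valid ŷ (conjugate Λ)
          valid-conj = valid-++ ŷ D (Λ ++ C) D-valid
                         (valid-++ s₁ Λ C (valid-cong Λ (λ j → sym (D-returns j)) (valid-from-x₀ lΛ))
                           (valid-cong C (λ j → sym (closes₁ j)) C-valid))
          gathered-end : Gathered (final ŷ (conjugate Λ))
          gathered-end j = trans (cong (λ z → z j) (final-++ ŷ D (Λ ++ C)))
                             (trans (cong (λ z → z j) (final-++ s₁ Λ C))
                               (trans (final-cong C closes₁ j) (ŷ-gathered j)))

      record Straightening (M : List Move) : Set where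
        field
          straight       : List Move
          straight-plain : Plain straight
          straight-loop  : GatheredLoop straight
          to-straight    : Homotopic ŷ M straight

      open Straightening

      straightening-extend : ∀ {M N} → Valid ŷ M → Homotopic ŷ M N → Straightening N → Straightening M
      straightening-extend _ h sN = record
        { straight = straight sN ; straight-plain = straight-plain sN ; straight-loop = straight-loop sN
        ; to-straight = h ◅◅ to-straight sN }

      -- A trailing permutation is pushed through C; at the gathered end it fixes the configuration.
      straighten-permute : ∀ P π → Plain P → Valid ŷ (P ++ permute π ∷ C) →
                           (∀ j → final ŷ P (π ⟨$⟩ʳ j) ≡ x₀ j) → Straightening (P ++ permute π ∷ C)
      straighten-permute P π pP v returns-x₀ = record
        { straight = M ; straight-plain = plain-++ (plain-++ pP (relabel-plain π C-plain)) (idle∷ [])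
        ; straight-loop = gathered-loop ŷ-gathered (homotopic-valid homotopy v) gathered-end ; to-straight = homotopy }
        where
          M = (P ++ relabel π C) ++ idle ∷ []
          tP = final ŷ P
          pushed = permute-past π C C-plain (valid-++ʳ ŷ P _ v)
          back-to-ŷ : final tP (permute π ∷ C) ≗ ŷ
          back-to-ŷ = final-cong C returns-x₀
          tπ : ∀ j → final tP (relabel π C) (π ⟨$⟩ʳ j) ≡ a
          tπ j = trans (sym (cong (λ z → z j) (final-++ tP (relabel π C) (permute π ∷ []))))
                   (trans (sym (homotopic-final pushed j)) (trans (back-to-ŷ j) (ŷ-gathered j)))
          t-gathered : ∀ j → final ŷ (P ++ relabel π C) j ≡ a
          t-gathered j = trans (cong (λ z → z j) (final-++ ŷ P (relabel π C)))
                           (trans (cong (final tP (relabel π C)) (sym (inverseʳ π))) (tπ (π ⟨$⟩ˡ j)))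
          fixed : ∀ j → final ŷ (P ++ relabel π C) (π ⟨$⟩ʳ j) ≡ final ŷ (P ++ relabel π C) j
          fixed j = trans (t-gathered (π ⟨$⟩ʳ j)) (sym (t-gathered j))
          homotopy : Homotopic ŷ (P ++ permute π ∷ C) M
          homotopy = (under-prefix P (unconditionally pushed)
                      ⟫ by-≡ (sym (++-assoc P (relabel π C) (permute π ∷ [])))
                      ⟫ elementary-step (P ++ relabel π C) (permute π ∷ []) (idle ∷ []) [] (permute-fixed fixed)) v
          gathered-end : Gathered (final ŷ M)
          gathered-end j = trans (sym (homotopic-final homotopy j))
                             (trans (cong (λ z → z j) (final-++ ŷ P (permute π ∷ C))) (trans (back-to-ŷ j) (ŷ-gathered j)))

      straighten-jump : ∀ P → Plain P → Valid ŷ (P ++ jump x₀ ∷ C) → Straightening (P ++ jump x₀ ∷ C)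
      straighten-jump P pP v with ∼-move ≃-refl (proj₁ (valid-++ʳ ŷ P (jump x₀ ∷ C) v))
      ... | e , pe , legal , orbit π splits =
        straightening-extend v homotopy
          (straighten-permute (P ++ e ∷ []) π (plain-++ pP pe) (homotopic-valid homotopy v) returns-x₀)
        where
          homotopy : Homotopic ŷ (P ++ jump x₀ ∷ C) ((P ++ e ∷ []) ++ permute π ∷ C)
          homotopy = (by-≡ (sym (++-assoc P (jump x₀ ∷ []) C)) ⟫ idle-insert (P ++ jump x₀ ∷ []) C
                      ⟫ by-≡ (++-assoc P (jump x₀ ∷ []) (idle ∷ C))
                      ⟫ elementary-step P (jump x₀ ∷ idle ∷ []) (e ∷ permute π ∷ []) C (jump-split legal splits)
                      ⟫ by-≡ (sym (++-assoc P (e ∷ []) (permute π ∷ C)))) v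
          returns-x₀ : ∀ j → final ŷ (P ++ e ∷ []) (π ⟨$⟩ʳ j) ≡ x₀ j
          returns-x₀ j = trans (cong (λ z → z (π ⟨$⟩ʳ j)) (final-++ ŷ P (e ∷ []))) (splits j)

      straighten : ∀ {Λ} → MoveLoop Λ → Straightening (conjugate Λ)
      straighten {Λ} lΛ with shape lΛ
      ... | inj₁ pΛ = record
        { straight = conjugate Λ ; straight-plain = plain-++ (undo-plain x₀ C) (plain-++ pΛ C-plain)
        ; straight-loop = conjugate-loop lΛ ; to-straight = ε }
      ... | inj₂ (L , refl , pL) =
        straightening-extend v (≡⇒homotopic reassoc)
          (straighten-jump (D ++ L) (plain-++ (undo-plain x₀ C) pL) (subst (Valid ŷ) reassoc v))
        where
          v = GatheredLoop.valid-at (conjugate-loop lΛ) ŷ ŷ-gathered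
          reassoc : D ++ (L ++ jump x₀ ∷ []) ++ C ≡ (D ++ L) ++ jump x₀ ∷ C
          reassoc = trans (cong (D ++_) (++-assoc L (jump x₀ ∷ []) C)) (sym (++-assoc D L (jump x₀ ∷ C)))

      conjugates-commute : ∀ {Λ Λ'} → MoveLoop Λ → MoveLoop Λ' →
                           Homotopic ŷ (conjugate Λ ++ conjugate Λ') (conjugate Λ' ++ conjugate Λ)
      conjugates-commute {Λ} {Λ'} lΛ lΛ' =
        (under-suffix (conjugate Λ') (unconditionally (to-straight sΛ))
         ⟫ under-prefix M (λ _ → homotopic-cong (ŷ≗after sΛ) (to-straight sΛ'))
         ⟫ unconditionally (gathered-loops-commute M M′ (straight-plain sΛ) (straight-plain sΛ')
                              (straight-loop sΛ) (straight-loop sΛ') ŷ ŷ-gathered)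
         ⟫ under-suffix M (unconditionally (homotopic-sym (to-straight sΛ')))
         ⟫ under-prefix (conjugate Λ') (λ _ → homotopic-cong (ŷ≗after-conjugate lΛ') (homotopic-sym (to-straight sΛ))))
        (GatheredLoop.valid-at (gatheredLoop-++ (conjugate-loop lΛ) (conjugate-loop lΛ')) ŷ ŷ-gathered)
        where
          sΛ = straighten lΛ
          sΛ' = straighten lΛ'
          M = straight sΛ
          M′ = straight sΛ'
          ŷ≗after : ∀ {N} (sN : Straightening N) → ŷ ≗ final ŷ (straight sN)
          ŷ≗after sN = gathered-≗ ŷ-gathered (GatheredLoop.returns (straight-loop sN) ŷ ŷ-gathered)
          ŷ≗after-conjugate : ∀ {N} → MoveLoop N → ŷ ≗ final ŷ (conjugate N)
          ŷ≗after-conjugate lN = gathered-≗ ŷ-gathered (GatheredLoop.returns (conjugate-loop lN) ŷ ŷ-gathered)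

      round-trip-valid : Valid x₀ (C ++ D)
      round-trip-valid = valid-++ x₀ C D C-valid D-valid

      round-trip-returns : final x₀ (C ++ D) ≗ x₀
      round-trip-returns j = trans (cong (λ z → z j) (final-++ x₀ C D)) (D-returns j)

      insert-round-trip : ∀ s → s ≗ x₀ → ∀ Q → HomotopicIfValid s Q ((C ++ D) ++ Q)
      insert-round-trip s s≗x₀ Q vQ = homotopic-cong (λ j → sym (s≗x₀ j)) (homotopic-sym cancel)
        where
          vQ′ = valid-cong Q (λ j → trans (s≗x₀ j) (sym (round-trip-returns j))) vQ
          cancel : Homotopic x₀ ((C ++ D) ++ Q) Q
          cancel = under-suffix Q (undo-cancels C C-plain) (valid-++ x₀ (C ++ D) Q round-trip-valid vQ′)

      moveLoop-++-valid : ∀ {Λ Λ'} → MoveLoop Λ → MoveLoop Λ' → Valid x₀ (Λ ++ Λ')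
      moveLoop-++-valid {Λ} {Λ'} lΛ lΛ' =
        valid-++ x₀ Λ Λ' (valid-from-x₀ lΛ) (valid-cong Λ' (λ j → sym (closes lΛ j)) (valid-from-x₀ lΛ'))

      moveLoop-++-closes : ∀ {Λ Λ'} → MoveLoop Λ → MoveLoop Λ' → final x₀ (Λ ++ Λ') ≗ x₀
      moveLoop-++-closes {Λ} {Λ'} lΛ lΛ' j =
        trans (cong (λ z → z j) (final-++ x₀ Λ Λ')) (trans (final-cong Λ' (closes lΛ) j) (closes lΛ' j))

      conjugated-product : ∀ {Λ Λ'} → MoveLoop Λ → MoveLoop Λ' →
                           Homotopic x₀ (Λ ++ Λ') (C ++ (conjugate Λ ++ conjugate Λ') ++ D)
      conjugated-product {Λ} {Λ'} lΛ lΛ' =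
        (insert-round-trip x₀ (λ _ → refl) (Λ ++ Λ') ⟫ by-≡ (sym (++-assoc (C ++ D) Λ Λ'))
         ⟫ under-prefix P₁ (insert-round-trip _ P₁-returns Λ') ⟫ by-≡ (sym (++-identityʳ P₂))
         ⟫ under-prefix P₂ (insert-round-trip _ P₂-returns []) ⟫ by-≡ regroup)
        (moveLoop-++-valid lΛ lΛ')
        where
          P₁ = (C ++ D) ++ Λ
          P₁-returns : final x₀ P₁ ≗ x₀
          P₁-returns j = trans (cong (λ z → z j) (final-++ x₀ (C ++ D) Λ))
                           (trans (final-cong Λ round-trip-returns j) (closes lΛ j))
          P₂ = P₁ ++ ((C ++ D) ++ Λ')
          P₂-returns : final x₀ P₂ ≗ x₀
          P₂-returns j = trans (cong (λ z → z j) (final-++ x₀ P₁ ((C ++ D) ++ Λ')))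
                           (trans (cong (λ z → z j) (final-++ (final x₀ P₁) (C ++ D) Λ'))
                             (trans (final-cong Λ' (λ i → trans (final-cong (C ++ D) P₁-returns i) (round-trip-returns i)) j)
                               (closes lΛ' j)))
          open Algebra.Solver.Monoid (++-monoid Move)
          regroup : P₂ ++ ((C ++ D) ++ []) ≡ C ++ (conjugate Λ ++ conjugate Λ') ++ D
          regroup = solve 4 (λ C D L L' → (((C ⊕ D) ⊕ L) ⊕ ((C ⊕ D) ⊕ L')) ⊕ ((C ⊕ D) ⊕ id)
                                        ⊜ C ⊕ ((D ⊕ L ⊕ C) ⊕ (D ⊕ L' ⊕ C)) ⊕ D) refl C D Λ Λ'

      moveLoops-commute : ∀ {Λ Λ'} → MoveLoop Λ → MoveLoop Λ' → Homotopic x₀ (Λ ++ Λ') (Λ' ++ Λ)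
      moveLoops-commute {Λ} {Λ'} lΛ lΛ' =
        conjugated-product lΛ lΛ'
        ◅◅ homotopic-prefix C-valid
             (homotopic-suffix (conjugates-commute lΛ lΛ') valid-conj (valid-cong D ŷ≗end D-valid))
        ◅◅ homotopic-sym (conjugated-product lΛ' lΛ)
        where
          loop-conj = gatheredLoop-++ (conjugate-loop lΛ) (conjugate-loop lΛ')
          valid-conj = GatheredLoop.valid-at loop-conj ŷ ŷ-gathered
          ŷ≗end : ŷ ≗ final ŷ (conjugate Λ ++ conjugate Λ')
          ŷ≗end = gathered-≗ ŷ-gathered (GatheredLoop.returns loop-conj ŷ ŷ-gathered)

      padded-loops-commute : ∀ {Λ Λ'} → MoveLoop Λ → MoveLoop Λ' →
                             ∀ m m' → Homotopic x₀ (replicate m idle ++ Λ ++ Λ') (replicate m' idle ++ Λ' ++ Λ)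
      padded-loops-commute {Λ} {Λ'} lΛ lΛ' m m' =
        idles-delete m (Λ ++ Λ') (idles-valid x₀ m _ (moveLoop-++-valid lΛ lΛ'))
        ◅◅ moveLoops-commute lΛ lΛ'
        ◅◅ homotopic-sym (idles-delete m' (Λ' ++ Λ) (idles-valid x₀ m' _ (moveLoop-++-valid lΛ' lΛ)))

      -- Lifting loops of G⁽ⁿ⁾

      module Lifting (f : Loop (ReducedPower G n) x₀) where

        F : ℤ → Tup
        F = Loop.fun f

        N : ℕ
        N = Loop.bound f

        F-step : ∀ t → F (t ⊖ N) ∼ F (suc t ⊖ N)
        F-step t = subst (λ z → F (t ⊖ N) ∼ F z) ⊖-suc (EA⇒∼ (Loop.map f (t ⊖ N)))
          where
            ⊖-suc : (t ⊖ N) ℤ.+ 1ℤ ≡ suc t ⊖ N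
            ⊖-suc = trans (ℤP.distribˡ-⊖-+-pos 1 t N) (cong (_⊖ N) (ℕP.+-comm t 1))

        F-outside : ∀ i → N ≤ ∣ i ∣ → F i ≃ x₀
        F-outside i le = SameOrbit⇒≃ (Loop.based f i le)

        F-beyond : ∀ u → N ℕ.+ N ≤ u → F (u ⊖ N) ≃ x₀
        F-beyond u le = F-outside (u ⊖ N) (half≤∣⊖∣ le)

        record LiftFrom (s : Tup) (t k : ℕ) : Set where
          field
            body       : List Move
            body-plain : Plain body
            lifts-length : length (body ++ jump x₀ ∷ []) ≡ suc k
            lifts-valid  : Valid s (body ++ jump x₀ ∷ [])
            realises     : ∀ u → stateAt s (body ++ jump x₀ ∷ []) u ≃ F ((t ℕ.+ u) ⊖ N)

        open LiftFrom

        -- The last step is a jump onto x₀ itself, so that the lift closes exactly.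
        lift-from : ∀ k t s → s ≃ F (t ⊖ N) → N ℕ.+ N ≤ suc (t ℕ.+ k) → LiftFrom s t k
        lift-from zero t s s≃ far = record
          { body = [] ; body-plain = [] ; lifts-length = refl
          ; lifts-valid = ∼-resp-≃ (≃-sym s≃) (F-beyond (suc t) far′) (F-step t) , tt
          ; realises = realised }
          where
            far′ : N ℕ.+ N ≤ suc t
            far′ = subst (λ z → N ℕ.+ N ≤ suc z) (ℕP.+-identityʳ t) far
            realised : ∀ u → stateAt s (jump x₀ ∷ []) u ≃ F ((t ℕ.+ u) ⊖ N)
            realised zero    = subst (λ z → s ≃ F (z ⊖ N)) (sym (ℕP.+-identityʳ t)) s≃
            realised (suc u) = ≃-sym (F-beyond (t ℕ.+ suc u)
                                 (ℕP.≤-trans far′ (subst (suc t ≤_) (sym (ℕP.+-suc t u)) (s≤s (ℕP.m≤m+n t u)))))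
        lift-from (suc k) t s s≃ far with ∼-move s≃ (F-step t)
        ... | e , pe , legal , moved = record
          { body = e ∷ body rest ; body-plain = plain-++ pe (body-plain rest) ; lifts-length = cong suc (lifts-length rest)
          ; lifts-valid = legal , lifts-valid rest ; realises = realised }
          where
            rest = lift-from k (suc t) (apply s e) moved (subst (λ z → N ℕ.+ N ≤ suc z) (ℕP.+-suc t k) far)
            realised : ∀ u → stateAt s (e ∷ body rest ++ jump x₀ ∷ []) u ≃ F ((t ℕ.+ u) ⊖ N)
            realised zero    = subst (λ z → s ≃ F (z ⊖ N)) (sym (ℕP.+-identityʳ t)) s≃
            realised (suc u) = subst (λ z → stateAt (apply s e) (body rest ++ jump x₀ ∷ []) u ≃ F (z ⊖ N))
                                 (sym (ℕP.+-suc t u)) (realises rest u)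

        record LiftedLoop : Set where
          field
            moves        : List Move
            is-loop      : MoveLoop moves
            moves-length : length moves ≡ N ℕ.+ N
            realises-F   : ∀ u → stateAt x₀ moves u ≃ F (u ⊖ N)

        lifted : LiftedLoop
        lifted with N in N≡
        ... | zero = record
          { moves = [] ; is-loop = record { valid-from-x₀ = tt ; closes = λ _ → refl ; shape = inj₁ [] }
          ; moves-length = sym (cong₂ ℕ._+_ N≡ N≡)
          ; realises-F = λ u → ≃-sym (F-outside (u ⊖ N) (subst (_≤ ∣ u ⊖ N ∣) (sym N≡) z≤n)) }
        ... | suc M = record
          { moves = body L ++ jump x₀ ∷ []
          ; is-loop = record { valid-from-x₀ = lifts-valid L ; closes = closes-at-x₀
                             ; shape = inj₂ (body L , refl , body-plain L) }
          ; moves-length = trans (lifts-length L) (sym (cong₂ ℕ._+_ N≡ N≡))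
          ; realises-F = realises L }
          where
            start : x₀ ≃ F (0 ⊖ N)
            start = ≃-sym (F-outside (0 ⊖ N) (ℕP.≤-reflexive (sym (ℤP.∣⊖∣-≤ z≤n))))
            L = lift-from (M ℕ.+ suc M) 0 x₀ start (ℕP.≤-reflexive (cong₂ ℕ._+_ N≡ N≡))
            closes-at-x₀ : final x₀ (body L ++ jump x₀ ∷ []) ≗ x₀
            closes-at-x₀ j = cong (λ z → z j) (final-++ x₀ (body L) (jump x₀ ∷ []))

      open Lifting using (lifted; LiftedLoop)
      open LiftedLoop

      module Concatenation (f g : Loop (ReducedPower G n) x₀) where

        Λ Λ' : List Move
        Λ  = moves (lifted f)
        Λ' = moves (lifted g)

        N : ℕ
        N = Lifting.N f

        F : ℤ → Tup
        F = Lifting.F f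

        realised : ∀ i → row x₀ (Λ ++ Λ') (i ℤ.+ + (N ℕ.+ N)) ≃ concat (ReducedPower G n) x₀ f g i
        realised (+ k) =
          ≃-trans (≗⇒≃ in-second)
            (subst (λ z → stateAt x₀ Λ' k ≃ Lifting.F g z) (sym (ℤP.m-n≡m⊖n k (Lifting.N g))) (realises-F (lifted g) k))
          where
            shift : k ℕ.+ (N ℕ.+ N) ≡ length Λ ℕ.+ k
            shift = trans (ℕP.+-comm k _) (cong (ℕ._+ k) (sym (moves-length (lifted f))))
            in-second : stateAt x₀ (Λ ++ Λ') (k ℕ.+ (N ℕ.+ N)) ≗ stateAt x₀ Λ' k
            in-second j = trans (cong (λ z → stateAt x₀ (Λ ++ Λ') z j) shift)
                            (trans (cong (λ z → z j) (stateAt-++ʳ x₀ Λ Λ' k))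
                              (stateAt-cong Λ' (MoveLoop.closes (is-loop (lifted f))) k j))
        realised -[1+ k ] with suc k ℕ.≤? N ℕ.+ N
        ... | yes k<2N =
          subst (λ z → row x₀ (Λ ++ Λ') z ≃ F (N ⊖ suc k)) (sym (ℤP.⊖-≥ k<2N))
            (≃-trans (≗⇒≃ λ j → cong (λ z → z j) (stateAt-++ˡ x₀ Λ Λ' t t≤))
              (subst (λ z → stateAt x₀ Λ t ≃ F z) (⊖-half {N} k<2N) (realises-F (lifted f) t)))
          where
            t = (N ℕ.+ N) ℕ.∸ suc k
            t≤ : t ≤ length Λ
            t≤ = subst (t ≤_) (sym (moves-length (lifted f))) (ℕP.m∸n≤m _ (suc k))
        ... | no k≮2N =
          subst (λ z → row x₀ (Λ ++ Λ') z ≃ F (N ⊖ suc k)) (sym (ℤP.⊖-≤ 2N≤k))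
            (subst (_≃ F (N ⊖ suc k)) (sym (row-nonpositive x₀ _ (suc k ℕ.∸ (N ℕ.+ N))))
              (≃-sym (Lifting.F-outside f _ (subst (N ≤_) (ℤP.∣m⊖n∣≡∣n⊖m∣ (suc k) N) (half≤∣⊖∣ 2N≤k)))))
          where
            2N≤k : N ℕ.+ N ≤ suc k
            2N≤k = ℕP.<⇒≤ (ℕP.≰⇒> k≮2N)

        padded-realised : ∀ m i → row x₀ (replicate m idle ++ Λ ++ Λ') (i ℤ.+ + ((N ℕ.+ N) ℕ.+ m))
                                  ≃ concat (ReducedPower G n) x₀ f g i
        padded-realised m i = subst (_≃ concat (ReducedPower G n) x₀ f g i) (sym unpad) (realised i)
          where
            unpad : row x₀ (replicate m idle ++ Λ ++ Λ') (i ℤ.+ + ((N ℕ.+ N) ℕ.+ m))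
                    ≡ row x₀ (Λ ++ Λ') (i ℤ.+ + (N ℕ.+ N))
            unpad = trans (cong (row x₀ (replicate m idle ++ Λ ++ Λ'))
                            (trans (cong (λ q → i ℤ.+ q) (ℤP.pos-+ (N ℕ.+ N) m))
                                   (sym (ℤP.+-assoc i (+ (N ℕ.+ N)) (+ m)))))
                          (row-idles x₀ m (Λ ++ Λ') (i ℤ.+ + (N ℕ.+ N)))

      -- Idles are prepended so that both concatenations are realised with the same shift.
      A₁-abelian : A₁Abelian (ReducedPower G n) x₀
      A₁-abelian f g =
        homotopic⇒BasedHomotopy
          (padded-loops-commute lΛ lΛ' 2N′ 2N) (idles-valid x₀ 2N′ _ (moveLoop-++-valid lΛ lΛ'))
          (λ j → trans (cong (λ z → z j) (idles-final x₀ 2N′ _)) (moveLoop-++-closes lΛ lΛ' j))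
          (2N ℕ.+ 2N′) (concat (ReducedPower G n) x₀ f g) (concat (ReducedPower G n) x₀ g f)
          (Concatenation.padded-realised f g 2N′)
          (λ i → subst (λ z → row x₀ (replicate 2N idle ++ Λ' ++ Λ) (i ℤ.+ + z) ≃ concat (ReducedPower G n) x₀ g f i)
                   (ℕP.+-comm 2N′ 2N) (Concatenation.padded-realised g f 2N i))
        where
          open Concatenation f g using (Λ; Λ')
          lΛ = is-loop (lifted f)
          lΛ' = is-loop (lifted g)
          2N = Lifting.N f ℕ.+ Lifting.N f
          2N′ = Lifting.N g ℕ.+ Lifting.N g

proposition4p6 : (G : Graph) → Connected G → LocallyFinite G →
                 (n : ℕ) → 2 ≤ n →
                 (x₀ : Tuple G n) → A₁Abelian (ReducedPower G n) x₀
proposition4p6 G connected _ (suc (suc m)) (s≤s (s≤s z≤n)) x₀ = Gathering.A₁-abelian G n (x₀ zero) other connected x₀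
  where
    n = suc (suc m)
    other : (k : Fin n) → ∃ λ k' → k' ≢ k
    other zero    = suc zero , λ ()
    other (suc _) = zero , λ ()
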